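{- Let $k$ be a positive integer. Then $P_{2k+1,2k+3}=Q_k\cup Q'_k$, where $Q_k=\{2i-1\mid 1\le i\le k\}$ and $Q'_k=\{2i+(s-1)(2k+3)\mid 1\le s\le 2k,\ 1\le i\le 2k+1-s\}$.
   Context: For positive integers $s,t$, $P_{s,t}=\mathbb{N}^+\setminus\{k_1s+k_2t\mid k_1,k_2\in\mathbb{N}\}$, where $\mathbb N=\{0,1,2,\dots\}$. -}

module Defs where

open import Data.Nat using (ℕ; zero; suc; _+_; _*_; _∸_; _≤_; _<_)
open import Data.Product using (Σ; ∃; _×_; _,_)
open import Relation.Nullary using (¬_)
open import Relation.Binary.PropositionalEquality using (_≡_)

Representable : ℕ → ℕ → ℕ → Set
Representable s t n = Σ ℕ λ k₁ → Σ ℕ λ k₂ → n ≡ k₁ * s + k₂ * t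

P : ℕ → ℕ → ℕ → Set
P s t n = (1 ≤ n) × ¬ Representable s t n

Q : ℕ → ℕ → Set
Q k n = Σ ℕ λ i → (1 ≤ i) × (i ≤ k) × (n ≡ 2 * i ∸ 1)

Q' : ℕ → ℕ → Set
Q' k n = Σ ℕ λ s → Σ ℕ λ i →
  (1 ≤ s) × (s ≤ 2 * k) × (1 ≤ i) × (i ≤ 2 * k + 1 ∸ s) ×
  (n ≡ 2 * i + (s ∸ 1) * (2 * k + 3))

-- With a = 2k + 1 we have x a + y (a + 2) = (x + y) a + 2 y, so n is representable
-- exactly when n = m a + 2 y with y ≤ m.  Dividing by a, every n is an odd number
-- below a or of the form m a + 2 c with c ≤ 2 k.  Odd numbers below a are gaps
-- (they are neither 0 nor ≥ a), giving Q_k; a number m a + 2 c is a gap exactly when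
-- m < c, and these are Q'_k reindexed by s = m + 1 and c = m + i.

module Submission where

open import Defs
open import Data.Nat using (ℕ; _+_; _*_; _≤_)
open import Data.Sum using (_⊎_)
open import Function.Bundles using (_⇔_)

open import Data.Nat using (zero; suc; _∸_; _<_; _≤?_; z≤n; s≤s)
open import Data.Nat.Properties
open import Data.Nat.DivMod using (_/_; _%_; m≡m%n+[m/n]*n; m%n<n)
open import Data.Nat.Tactic.RingSolver using (solve-∀)
open import Data.Product using (∃-syntax; _×_; _,_)
open import Data.Sum using (inj₁; inj₂)
open import Function.Bundles using (mk⇔)
open import Relation.Nullary using (yes; no; contradiction)
open import Relation.Binary.PropositionalEquality

even-or-odd : ∀ n → ∃[ h ] (n ≡ 2 * h ⊎ n ≡ suc (2 * h))
even-or-odd zero = 0 , inj₁ refl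
even-or-odd (suc n) with even-or-odd n
... | h , inj₁ n≡2h   = h , inj₂ (cong suc n≡2h)
... | h , inj₂ n≡1+2h = suc h , inj₁ (trans (cong suc n≡1+2h) (2+2h≡2[1+h] h))
  where
  2+2h≡2[1+h] : ∀ h → suc (suc (2 * h)) ≡ 2 * suc h
  2+2h≡2[1+h] = solve-∀

below-not-offset : ∀ {a n m y} → 0 < n → n < a → y ≤ m → n ≢ m * a + 2 * y
below-not-offset {m = zero}  0<n _   z≤n n≡0 = <⇒≢ 0<n (sym n≡0)
below-not-offset {a} {m = suc m} {y} _ n<a _ n≡ =
  <⇒≱ n<a (subst (a ≤_) (sym n≡) (≤-trans (m≤m+n a (m * a)) (m≤m+n _ (2 * y))))

module _ (k : ℕ) where

  -- 2 * k + 1, written so that it is a NonZero instance and ≤-pred applies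
  a : ℕ
  a = suc (2 * k)

  OddBelow : ℕ → Set
  OddBelow n = ∃[ i ] (i < k × n ≡ suc (2 * i))

  Offset : ℕ → Set
  Offset n = ∃[ m ] ∃[ c ] (c ≤ 2 * k × n ≡ m * a + 2 * c)

  Gap : ℕ → Set
  Gap n = ∃[ m ] ∃[ c ] (m < c × c ≤ 2 * k × n ≡ m * a + 2 * c)

  representable⇒offset : ∀ {n} → Representable (2 * k + 1) (2 * k + 3) n →
                         ∃[ m ] ∃[ y ] (y ≤ m × n ≡ m * a + 2 * y)
  representable⇒offset (x , y , n≡) = x + y , y , m≤n+m y x , trans n≡ (level-offset k x y)
    where
    level-offset : ∀ k x y → x * (2 * k + 1) + y * (2 * k + 3)
                           ≡ (x + y) * suc (2 * k) + 2 * y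
    level-offset = solve-∀

  offset⇒representable : ∀ {m y} → y ≤ m →
                         Representable (2 * k + 1) (2 * k + 3) (m * a + 2 * y)
  offset⇒representable {y = y} y≤m with m≤n⇒∃[o]m+o≡n y≤m
  ... | x , refl = x , y , offset-level k x y
    where
    offset-level : ∀ k x y → (y + x) * suc (2 * k) + 2 * y
                           ≡ x * (2 * k + 1) + y * (2 * k + 3)
    offset-level = solve-∀

  2c≢[1+d]a+2y : ∀ {c d y} → c ≤ 2 * k → 2 * c ≢ suc d * a + 2 * y
  2c≢[1+d]a+2y {c} {zero} {y} _ 2c≡ = even≢odd c (k + y) (trans 2c≡ (a+2y≡1+2[k+y] k y))
    where
    a+2y≡1+2[k+y] : ∀ k y → 1 * suc (2 * k) + 2 * y ≡ suc (2 * (k + y))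
    a+2y≡1+2[k+y] = solve-∀
  2c≢[1+d]a+2y {c} {suc d} {y} c≤2k 2c≡ = <⇒≱ 2c<2a (subst (2 * a ≤_) (sym 2c≡) 2a≤)
    where
    2c<2a : 2 * c < 2 * a
    2c<2a = *-monoʳ-< 2 (s≤s c≤2k)
    2a≤ : 2 * a ≤ suc (suc d) * a + 2 * y
    2a≤ = ≤-trans (*-monoˡ-≤ a (s≤s (s≤s (z≤n {d})))) (m≤m+n _ (2 * y))

  -- A lower level m′ ≤ m stays below m a + 2 c; a higher one differs from it by d a
  -- with d ≥ 1, which is too large for d ≥ 2 and of the wrong parity for d = 1.
  gap-not-offset : ∀ {m c m′ y} → m < c → c ≤ 2 * k → y ≤ m′ →
                   m * a + 2 * c ≢ m′ * a + 2 * y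
  gap-not-offset {m} {c} {m′} {y} m<c c≤2k y≤m′ eq with m′ ≤? m
  ... | yes m′≤m = <⇒≢ (+-mono-≤-< (*-monoˡ-≤ a m′≤m) (*-monoʳ-< 2 y<c)) (sym eq)
    where
    y<c : y < c
    y<c = ≤-<-trans y≤m′ (≤-<-trans m′≤m m<c)
  ... | no m′≰m with m≤n⇒∃[o]m+o≡n (≰⇒> m′≰m)
  ...   | d , refl =
    2c≢[1+d]a+2y {d = d} {y} c≤2k (+-cancelˡ-≡ (m * a) _ _ (trans eq (split k m d y)))
    where
    split : ∀ k m d y → (suc m + d) * suc (2 * k) + 2 * y
                      ≡ m * suc (2 * k) + (suc d * suc (2 * k) + 2 * y)
    split = solve-∀

  -- An odd remainder borrows one a from the quotient: 2h + 1 + a = 2 (k + h + 1).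
  odd-below-or-offset : ∀ n → OddBelow n ⊎ Offset n
  odd-below-or-offset n = from-division (n / a) (n % a) (m%n<n n a) (m≡m%n+[m/n]*n n a)
    where
    from-division : ∀ q r → r < a → n ≡ r + q * a → OddBelow n ⊎ Offset n
    from-division q r r<a n≡ with even-or-odd r
    ... | h , inj₁ refl = inj₂ (q , h , h≤2k , trans n≡ (+-comm (2 * h) (q * a)))
      where
      h≤2k : h ≤ 2 * k
      h≤2k = ≤-trans (*-cancelˡ-≤ 2 (≤-pred r<a)) (m≤m+n k (k + 0))
    ... | h , inj₂ refl with *-cancelˡ-< 2 h k (≤-pred r<a)
    ...   | h<k with q
    ...     | zero  = inj₁ (h , h<k , trans n≡ (+-identityʳ _))
    ...     | suc q = inj₂ (q , suc (k + h) , +-monoʳ-< k (<-≤-trans h<k (m≤m+n k 0)) ,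
                            trans n≡ (carry k h q))
      where
      carry : ∀ k h q → suc (2 * h) + suc q * suc (2 * k)
                      ≡ q * suc (2 * k) + 2 * suc (k + h)
      carry = solve-∀

  odd⇒Q : ∀ {i} → i < k → Q k (suc (2 * i))
  odd⇒Q {i} i<k = suc i , s≤s z≤n , i<k , sym (+-suc i (i + 0))

  Q⇒P : ∀ {n} → Q k n → P (2 * k + 1) (2 * k + 3) n
  Q⇒P (suc i , _ , i<k , n≡) rewrite n≡ | +-suc i (i + 0) = s≤s z≤n , λ rep →
    let m , y , y≤m , n≡′ = representable⇒offset rep
    in below-not-offset (s≤s z≤n) (s≤s (*-monoʳ-< 2 i<k)) y≤m n≡′

  Gap⇒P : ∀ {n} → Gap n → P (2 * k + 1) (2 * k + 3) n
  Gap⇒P (m , c , m<c , c≤2k , refl) = 0<n , λ rep →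
    let m′ , y , y≤m′ , n≡ = representable⇒offset rep
    in gap-not-offset m<c c≤2k y≤m′ n≡
    where
    0<n : 0 < m * a + 2 * c
    0<n = <-≤-trans (*-monoʳ-< 2 (≤-<-trans z≤n m<c)) (m≤n+m (2 * c) (m * a))

  2k+1∸[1+m]≡2k∸m : ∀ m → 2 * k + 1 ∸ suc m ≡ 2 * k ∸ m
  2k+1∸[1+m]≡2k∸m m = cong (_∸ suc m) (+-comm (2 * k) 1)

  Q'⇒Gap : ∀ {n} → Q' k n → Gap n
  Q'⇒Gap (suc m , suc i , _ , 1+m≤2k , _ , i≤ , n≡) =
    m , m + suc i , m<m+n m (s≤s z≤n) , m+1+i≤2k , trans n≡ (regroup k m i)
    where
    m+1+i≤2k : m + suc i ≤ 2 * k
    m+1+i≤2k = subst (_≤ 2 * k) (+-comm (suc i) m)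
                 (m≤o∸n⇒m+n≤o (suc i) (<⇒≤ 1+m≤2k) (subst (suc i ≤_) (2k+1∸[1+m]≡2k∸m m) i≤))
    regroup : ∀ k m i → 2 * suc i + m * (2 * k + 3) ≡ m * suc (2 * k) + 2 * (m + suc i)
    regroup = solve-∀

  Gap⇒Q' : ∀ {n} → Gap n → Q' k n
  Gap⇒Q' (m , c , m<c , c≤2k , n≡) with m≤n⇒∃[o]m+o≡n m<c
  ... | o , refl = suc m , suc o , s≤s z≤n , ≤-trans (m≤m+n (suc m) o) c≤2k , s≤s z≤n ,
                   subst (suc o ≤_) (sym (2k+1∸[1+m]≡2k∸m m))
                     (m+n≤o⇒m≤o∸n (suc o) (subst (_≤ 2 * k) (cong suc (+-comm m o)) c≤2k)) ,
                   trans n≡ (regroup k m o)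
    where
    regroup : ∀ k m o → m * suc (2 * k) + 2 * (suc m + o) ≡ 2 * suc o + m * (2 * k + 3)
    regroup = solve-∀

lemma1 : (k : ℕ) → 1 ≤ k → (n : ℕ) →
    P (2 * k + 1) (2 * k + 3) n ⇔ (Q k n ⊎ Q' k n)
lemma1 k _ n = mk⇔ to from
  where
  to : P (2 * k + 1) (2 * k + 3) n → Q k n ⊎ Q' k n
  to (_ , unrepresentable) with odd-below-or-offset k n
  ... | inj₁ (i , i<k , refl) = inj₁ (odd⇒Q k i<k)
  ... | inj₂ (m , c , c≤2k , refl) with c ≤? m
  ...   | yes c≤m = contradiction (offset⇒representable k c≤m) unrepresentable
  ...   | no c≰m  = inj₂ (Gap⇒Q' k (m , c , ≰⇒> c≰m , c≤2k , refl))
  from : Q k n ⊎ Q' k n → P (2 * k + 1) (2 * k + 3) n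
  from (inj₁ q)  = Q⇒P k q
  from (inj₂ q′) = Gap⇒P k (Q'⇒Gap k q′)
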